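{- Let $G$ be a graph, $t\ge 1$ an integer, and $S=\{v_1,\dots,v_t\}$ a set of $t$ distinct vertices of $G$. If $G-S$ has an equitable $t$-tree-coloring and $|N_G(v_i)\setminus S|\le 2i-1$ for every $1\le i\le t$, then $G$ has an equitable $t$-tree-coloring.
   Context: A $t$-coloring of $G$ is a map $f:V(G)\to\{1,\dots,t\}$ (not necessarily surjective) with color classes $V_i=f^{ -1}(i)$; it is equitable if $||V_i|-|V_j||\le 1$ for all $i,j$. An equitable $t$-tree-coloring is an equitable $t$-coloring in which every color class induces a forest. $N_G(v)$ denotes the set of neighbors of $v$ in $G$. -}

module Defs where

open import Data.Nat using (ℕ; zero; suc; _+_; _*_; _≤_)
open import Data.Fin using (Fin; zero; suc; inject₁; fromℕ; toℕ; _≟_)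
open import Data.Fin.Subset using (Subset; _∈_; _∩_; ∁; ∣_∣)
open import Data.Fin.Properties using (any?)
open import Data.Vec using (tabulate)
open import Data.Bool using (Bool; true; false; _∧_)
open import Data.Product using (Σ; _×_)
open import Relation.Nullary using (¬_; Dec)
open import Relation.Nullary.Decidable using (⌊_⌋)
open import Relation.Binary.PropositionalEquality using (_≡_)
open import Function.Definitions using (Injective)
open import Data.Fin.Subset.Properties using (_∈?_)

record Graph : Set₁ where
  field
    n      : ℕ
    Adj    : Fin n → Fin n → Set
    adj?   : (u v : Fin n) → Dec (Adj u v)
    sym    : ∀ {u v} → Adj u v → Adj v u
    irrefl : ∀ {u} → ¬ Adj u u

module _ (G : Graph) where
  open Graph G

  record CycleIn (W : Subset n) : Set where
    field
      k      : ℕ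
      c      : Fin (3 + k) → Fin n
      inj    : Injective _≡_ _≡_ c
      inW    : ∀ i → c i ∈ W
      step   : ∀ (i : Fin (2 + k)) → Adj (c (inject₁ i)) (c (suc i))
      close  : Adj (c (fromℕ (2 + k))) (c zero)

  InducesForest : Subset n → Set
  InducesForest W = ¬ CycleIn W

  colourClass : {t : ℕ} → Subset n → (Fin n → Fin t) → Fin t → Subset n
  colourClass U f i = tabulate (λ v → ⌊ v ∈? U ⌋ ∧ ⌊ f v ≟ i ⌋)

  -- An equitable t-tree-colouring of the induced subgraph G[U]
  -- (values of f outside U are irrelevant).
  IsEquitableTreeColouring : (t : ℕ) → Subset n → (Fin n → Fin t) → Set
  IsEquitableTreeColouring t U f =
    (∀ i j → ∣ colourClass U f i ∣ ≤ ∣ colourClass U f j ∣ + 1)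
    × (∀ i → InducesForest (colourClass U f i))

  HasEquitableTreeColouring : (t : ℕ) → Subset n → Set
  HasEquitableTreeColouring t U = Σ (Fin n → Fin t) (IsEquitableTreeColouring t U)

  allV : Subset n
  allV = tabulate (λ _ → true)

  setOf : {t : ℕ} → (Fin t → Fin n) → Subset n
  setOf vs = tabulate (λ w → ⌊ any? (λ i → vs i ≟ w) ⌋)

  nbhd : Fin n → Subset n
  nbhd v = tabulate (λ w → ⌊ adj? v w ⌋)

module Submission where

-- Colour v_t, v_{t-1}, ..., v_1 in turn, each with a colour not yet used on S.
-- When v_i is treated, i colours are still free; as v_i has at most 2i - 1
-- neighbours outside S, some free colour occurs at most once among them
-- (pigeonhole), and v_i takes it.  Every colour class then gains exactly one
-- vertex, so equitability survives, and the new vertex has at most one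
-- neighbour in its class, so it lies on no cycle and the class stays a forest.

open import Defs
open import Data.Nat using (ℕ; zero; suc; _+_; _*_; _∸_; _≤_; _<_; z≤n; s≤s)
open import Data.Nat.Properties
  using (+-suc; *-zeroʳ; *-suc; *-monoʳ-≤; +-mono-≤; ≤-trans; ≤-refl; >⇒≢; <⇒≱; ≰⇒>; _≤?_;
         suc-injective; module ≤-Reasoning)
open import Data.Fin using (Fin; zero; suc; toℕ; fromℕ; inject₁; _≟_)
open import Data.Fin.Properties using (toℕ-fromℕ; toℕ-inject₁; fromℕ≢inject₁; ≤̄⇒inject₁<; any?)
import Data.Fin.Properties as Fin
open import Data.Fin.Relation.Unary.Top using (View; view; ‵fromℕ; ‵inject₁; view-fromℕ; view-inject₁)
open import Data.Fin.Subset using (Subset; inside; outside; _∈_; _∉_; _⊆_; _∩_; _─_; _-_; ∁; ⁅_⁆; ⊤; ∣_∣; Nonempty)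
open import Data.Fin.Subset.Properties
  using (_∈?_; nonempty?; Empty-unique; ∣⊥∣≡0; ∣⊤∣≡n; ∈⊤; p─⊥≡p; p─q⊆p; p⊆q⇒∣p∣≤∣q∣; ⊆-antisym;
         x∈p∩q⁺; x∈p∩q⁻; x∈p∧x∉q⇒x∈p─q; x∈p∧x≢y⇒x∈p-y; x∉⁅y⁆⇒x≢y; x∉p⇒x∈∁p; x∈∁p⇒x∉p)
open import Data.Bool using (Bool; T)
open import Data.Bool.Properties using (T-≡; T-∧)
open import Data.Vec using (_∷_; []; here; there; tabulate)
open import Data.Vec.Properties using (lookup∘tabulate; lookup⇒[]=; []=⇒lookup)
open import Data.Product using (∃₂; ∃-syntax; _×_; _,_; proj₁; proj₂)
open import Function using (_∘_)
open import Function.Bundles using (Equivalence)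
open import Function.Definitions using (Injective)
open import Relation.Binary.PropositionalEquality using (_≡_; _≢_; refl; sym; trans; cong; subst; subst₂; ≢-sym)
open import Relation.Nullary using (yes; no; contradiction)
open import Relation.Nullary.Decidable using (⌊_⌋; toWitness; fromWitness; _×-dec_)

∣p∣≡∣p∩q∣+∣p─q∣ : ∀ {n} (p q : Subset n) → ∣ p ∣ ≡ ∣ p ∩ q ∣ + ∣ p ─ q ∣
∣p∣≡∣p∩q∣+∣p─q∣ []            []            = refl
∣p∣≡∣p∩q∣+∣p─q∣ (outside ∷ p) (inside  ∷ q) = ∣p∣≡∣p∩q∣+∣p─q∣ p q
∣p∣≡∣p∩q∣+∣p─q∣ (outside ∷ p) (outside ∷ q) = ∣p∣≡∣p∩q∣+∣p─q∣ p q
∣p∣≡∣p∩q∣+∣p─q∣ (inside  ∷ p) (inside  ∷ q) = cong suc (∣p∣≡∣p∩q∣+∣p─q∣ p q)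
∣p∣≡∣p∩q∣+∣p─q∣ (inside  ∷ p) (outside ∷ q) =
  trans (cong suc (∣p∣≡∣p∩q∣+∣p─q∣ p q)) (sym (+-suc _ _))

x∈p⇒∣p∣≡1+∣p-x∣ : ∀ {n} {x : Fin n} {p : Subset n} → x ∈ p → ∣ p ∣ ≡ suc ∣ p - x ∣
x∈p⇒∣p∣≡1+∣p-x∣ {p = inside ∷ p} here = cong (λ q → suc ∣ q ∣) (sym (p─⊥≡p p))
x∈p⇒∣p∣≡1+∣p-x∣ {p = outside ∷ p} (there x∈p) = x∈p⇒∣p∣≡1+∣p-x∣ x∈p
x∈p⇒∣p∣≡1+∣p-x∣ {p = inside  ∷ p} (there x∈p) = cong suc (x∈p⇒∣p∣≡1+∣p-x∣ x∈p)

x∈p─q⇒x∉q : ∀ {n} {x : Fin n} {p q : Subset n} → x ∈ p ─ q → x ∉ q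
x∈p─q⇒x∉q {p = inside ∷ p} {outside ∷ q} here ()
x∈p─q⇒x∉q {p = _ ∷ _} {_ ∷ _} (there x∈p─q) (there x∈q) = x∈p─q⇒x∉q x∈p─q x∈q

0<∣p∣⇒Nonempty : ∀ {n} {p : Subset n} → 0 < ∣ p ∣ → Nonempty p
0<∣p∣⇒Nonempty {n} {p} 0<∣p∣ with nonempty? p
... | yes ne = ne
... | no ¬ne = contradiction (trans (cong ∣_∣ (Empty-unique ¬ne)) (∣⊥∣≡0 n)) (>⇒≢ 0<∣p∣)

x∈p∧y∈p∧x≢y⇒2≤∣p∣ : ∀ {n} {x y : Fin n} {p : Subset n} → x ∈ p → y ∈ p → x ≢ y → 2 ≤ ∣ p ∣
x∈p∧y∈p∧x≢y⇒2≤∣p∣ {x = x} {y} {p} x∈p y∈p x≢y =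
  subst (2 ≤_) (sym (trans (x∈p⇒∣p∣≡1+∣p-x∣ x∈p) (cong suc (x∈p⇒∣p∣≡1+∣p-x∣ y∈p-x)))) (s≤s (s≤s z≤n))
  where
  y∈p-x : y ∈ p - x
  y∈p-x = x∈p∧x≢y⇒x∈p-y y∈p (x≢y ∘ sym)

PairwiseDisjoint : ∀ {n t} → (Fin t → Subset n) → Set
PairwiseDisjoint P = ∀ {c d x} → x ∈ P c → x ∈ P d → c ≡ d

disjoint-pigeonhole : ∀ {n t} {P : Fin t → Subset n} → PairwiseDisjoint P →
  ∀ k (N : Subset n) (B : Subset t) → (∀ {c} → c ∈ B → k ≤ ∣ N ∩ P c ∣) → k * ∣ B ∣ ≤ ∣ N ∣
disjoint-pigeonhole {t = t} {P} disjoint k N B = go ∣ B ∣ N B refl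
  where
  go : ∀ m N (B : Subset t) → ∣ B ∣ ≡ m → (∀ {c} → c ∈ B → k ≤ ∣ N ∩ P c ∣) → k * m ≤ ∣ N ∣
  go zero N B _ _ = subst (_≤ ∣ N ∣) (sym (*-zeroʳ k)) z≤n
  go (suc m) N B ∣B∣≡1+m large with 0<∣p∣⇒Nonempty (subst (0 <_) (sym ∣B∣≡1+m) (s≤s z≤n))
  ... | c , c∈B = begin
    k * suc m                 ≡⟨ *-suc k m ⟩
    k + k * m                 ≤⟨ +-mono-≤ (large c∈B) (go m (N ─ P c) (B - c) ∣B-c∣≡m large′) ⟩
    ∣ N ∩ P c ∣ + ∣ N ─ P c ∣ ≡⟨ sym (∣p∣≡∣p∩q∣+∣p─q∣ N (P c)) ⟩
    ∣ N ∣                     ∎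
    where
    open ≤-Reasoning
    ∣B-c∣≡m : ∣ B - c ∣ ≡ m
    ∣B-c∣≡m = suc-injective (trans (sym (x∈p⇒∣p∣≡1+∣p-x∣ c∈B)) ∣B∣≡1+m)
    large′ : ∀ {d} → d ∈ B - c → k ≤ ∣ (N ─ P c) ∩ P d ∣
    large′ {d} d∈B-c = ≤-trans (large (p─q⊆p B ⁅ c ⁆ d∈B-c)) (p⊆q⇒∣p∣≤∣q∣ N∩Pd⊆)
      where
      N∩Pd⊆ : N ∩ P d ⊆ (N ─ P c) ∩ P d
      N∩Pd⊆ x∈N∩Pd with x∈p∩q⁻ N (P d) x∈N∩Pd
      ... | x∈N , x∈Pd = x∈p∩q⁺ (x∈p∧x∉q⇒x∈p─q x∈N (x∉⁅y⁆⇒x≢y (x∈p─q⇒x∉q d∈B-c) ∘ disjoint x∈Pd) , x∈Pd)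

record GoodBijection {m t} (A : Subset t) (Good : Fin m → Fin t → Set) : Set where
  field
    σ           : Fin m → Fin t
    σ-∈         : ∀ i → σ i ∈ A
    σ-injective : Injective _≡_ _≡_ σ
    σ-onto      : ∀ {c} → c ∈ A → ∃[ i ] σ i ≡ c
    σ-good      : ∀ i → Good i (σ i)

-- Indices are matched from the largest down, so when index i chooses, the
-- toℕ i + 1 colours of A not yet taken are still free.
greedy-goodBijection : ∀ {m t} (A : Subset t) → ∣ A ∣ ≡ m → (Good : Fin m → Fin t → Set) →
                       (∀ i (B : Subset t) → toℕ i < ∣ B ∣ → ∃[ c ] c ∈ B × Good i c) →
                       GoodBijection A Good
greedy-goodBijection {zero} A ∣A∣≡0 _ _ = record
  { σ = λ ()
  ; σ-∈ = λ ()
  ; σ-injective = λ { {()} }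
  ; σ-onto = λ c∈A → contradiction (trans (sym ∣A∣≡0) (x∈p⇒∣p∣≡1+∣p-x∣ c∈A)) λ ()
  ; σ-good = λ ()
  }
greedy-goodBijection {suc m} {t} A ∣A∣≡1+m Good hasGood = record
  { σ = σ
  ; σ-∈ = λ i → pick-∈ (view i)
  ; σ-injective = λ {i} {j} → pick-injective (view i) (view j)
  ; σ-onto = onto
  ; σ-good = λ i → pick-good (view i)
  }
  where
  top : ∃[ c ] c ∈ A × Good (fromℕ m) c
  top = hasGood (fromℕ m) A (subst₂ _<_ (sym (toℕ-fromℕ m)) (sym ∣A∣≡1+m) ≤-refl)
  c : Fin t
  c = proj₁ top
  c∈A : c ∈ A
  c∈A = proj₁ (proj₂ top)

  rest : GoodBijection (A - c) (Good ∘ inject₁)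
  rest = greedy-goodBijection (A - c) (suc-injective (trans (sym (x∈p⇒∣p∣≡1+∣p-x∣ c∈A)) ∣A∣≡1+m)) (Good ∘ inject₁)
    λ j B j<∣B∣ → hasGood (inject₁ j) B (subst (_< ∣ B ∣) (sym (toℕ-inject₁ j)) j<∣B∣)
  open GoodBijection rest renaming (σ to τ; σ-∈ to τ-∈; σ-injective to τ-injective; σ-onto to τ-onto; σ-good to τ-good)

  τ≢c : ∀ j → τ j ≢ c
  τ≢c j = x∉⁅y⁆⇒x≢y (x∈p─q⇒x∉q (τ-∈ j))

  pick : ∀ {i : Fin (suc m)} → View i → Fin t
  pick ‵fromℕ       = c
  pick (‵inject₁ j) = τ j

  σ : Fin (suc m) → Fin t
  σ i = pick (view i)

  pick-∈ : ∀ {i} (v : View i) → pick v ∈ A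
  pick-∈ ‵fromℕ       = c∈A
  pick-∈ (‵inject₁ j) = p─q⊆p A ⁅ c ⁆ (τ-∈ j)

  pick-good : ∀ {i} (v : View i) → Good i (pick v)
  pick-good ‵fromℕ       = proj₂ (proj₂ top)
  pick-good (‵inject₁ j) = τ-good j

  pick-injective : ∀ {i i′} (v : View i) (w : View i′) → pick v ≡ pick w → i ≡ i′
  pick-injective ‵fromℕ       ‵fromℕ        _ = refl
  pick-injective ‵fromℕ       (‵inject₁ j′) e = contradiction (sym e) (τ≢c j′)
  pick-injective (‵inject₁ j) ‵fromℕ        e = contradiction e (τ≢c j)
  pick-injective (‵inject₁ j) (‵inject₁ j′) e = cong inject₁ (τ-injective e)

  onto : ∀ {d} → d ∈ A → ∃[ i ] σ i ≡ d
  onto {d} d∈A with d ≟ c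
  ... | yes refl = fromℕ m , cong pick (view-fromℕ m)
  ... | no d≢c with τ-onto (x∈p∧x≢y⇒x∈p-y d∈A d≢c)
  ...   | j , τj≡d = inject₁ j , trans (cong pick (view-inject₁ j)) τj≡d

∈-tabulate⁺ : ∀ {n} {f : Fin n → Bool} {x} → T (f x) → x ∈ tabulate f
∈-tabulate⁺ {f = f} {x} fx = lookup⇒[]= x (tabulate f) (trans (lookup∘tabulate f x) (Equivalence.to T-≡ fx))

∈-tabulate⁻ : ∀ {n} {f : Fin n → Bool} {x} → x ∈ tabulate f → T (f x)
∈-tabulate⁻ {f = f} {x} x∈ = Equivalence.from T-≡ (trans (sym (lookup∘tabulate f x)) ([]=⇒lookup x∈))

module _ (G : Graph) where
  open Graph G using (n; Adj) renaming (sym to Adj-sym)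

  ∈-allV : ∀ {v} → v ∈ allV G
  ∈-allV = ∈-tabulate⁺ _

  ∈-nbhd⁺ : ∀ {u v} → Adj u v → v ∈ nbhd G u
  ∈-nbhd⁺ uv = ∈-tabulate⁺ (fromWitness uv)

  ∈-setOf⁺ : ∀ {t} {vs : Fin t → Fin n} i → vs i ∈ setOf G vs
  ∈-setOf⁺ i = ∈-tabulate⁺ (fromWitness (i , refl))

  ∈-setOf⁻ : ∀ {t} {vs : Fin t → Fin n} {v} → v ∈ setOf G vs → ∃[ i ] vs i ≡ v
  ∈-setOf⁻ v∈S = toWitness (∈-tabulate⁻ v∈S)

  module _ {t} {U : Subset n} {f : Fin n → Fin t} where

    ∈-colourClass⁺ : ∀ {c v} → v ∈ U → f v ≡ c → v ∈ colourClass G U f c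
    ∈-colourClass⁺ {c} {v} v∈U fv≡c =
      ∈-tabulate⁺ (Equivalence.from (T-∧ {⌊ v ∈? U ⌋} {⌊ f v ≟ c ⌋}) (fromWitness v∈U , fromWitness fv≡c))

    ∈-colourClass⁻ : ∀ {c v} → v ∈ colourClass G U f c → v ∈ U × f v ≡ c
    ∈-colourClass⁻ {c} {v} v∈ with Equivalence.to (T-∧ {⌊ v ∈? U ⌋} {⌊ f v ≟ c ⌋}) (∈-tabulate⁻ v∈)
    ... | v∈U , fv≡c = toWitness v∈U , toWitness fv≡c

    colourClass-disjoint : PairwiseDisjoint (colourClass G U f)
    colourClass-disjoint v∈c v∈d = trans (sym (proj₂ (∈-colourClass⁻ v∈c))) (proj₂ (∈-colourClass⁻ v∈d))

  module _ {W : Subset n} (C : CycleIn G W) where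
    open CycleIn C

    NeighbourIndices : Fin (3 + k) → Set
    NeighbourIndices j = ∃₂ λ a b → a ≢ b × a ≢ j × b ≢ j × Adj (c j) (c a) × Adj (c j) (c b)

    cycle-neighbourIndices : ∀ j → NeighbourIndices j
    cycle-neighbourIndices j = go (view j)
      where
      go : ∀ {j} → View j → NeighbourIndices j
      go ‵fromℕ =
        inject₁ (fromℕ (suc k)) , zero , (λ ()) , fromℕ≢inject₁ ∘ sym , (λ ()) ,
        Adj-sym (step (fromℕ (suc k))) , close
      go (‵inject₁ zero) =
        fromℕ (2 + k) , suc zero , (λ ()) , (λ ()) , (λ ()) , Adj-sym close , step zero
      go (‵inject₁ (suc i)) =
        inject₁ (inject₁ i) , suc (suc i) , Fin.<⇒≢ (Fin.<-trans a<j j<b) , Fin.<⇒≢ a<j ,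
        ≢-sym (Fin.<⇒≢ j<b) , Adj-sym (step (inject₁ i)) , step (suc i)
        where
        a<j : toℕ (inject₁ (inject₁ i)) < toℕ (suc (inject₁ i))
        a<j = ≤̄⇒inject₁< Fin.≤-refl
        j<b : toℕ (suc (inject₁ i)) < toℕ (suc (suc i))
        j<b = s≤s (≤̄⇒inject₁< Fin.≤-refl)

    cycle-degree≥2 : ∀ j → 2 ≤ ∣ nbhd G (c j) ∩ (W - c j) ∣
    cycle-degree≥2 j with cycle-neighbourIndices j
    ... | a , b , a≢b , a≢j , b≢j , ja , jb =
      x∈p∧y∈p∧x≢y⇒2≤∣p∣ (neighbour a a≢j ja) (neighbour b b≢j jb) (a≢b ∘ inj)
      where
      neighbour : ∀ a → a ≢ j → Adj (c j) (c a) → c a ∈ nbhd G (c j) ∩ (W - c j)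
      neighbour a a≢j ja = x∈p∩q⁺ (∈-nbhd⁺ ja , x∈p∧x≢y⇒x∈p-y (inW a) (a≢j ∘ inj))

  forest-extend : ∀ {W x} → InducesForest G (W - x) → ∣ nbhd G x ∩ (W - x) ∣ ≤ 1 → InducesForest G W
  forest-extend {x = x} forest deg C with any? (λ j → CycleIn.c C j ≟ x)
  ... | yes (j , refl) = <⇒≱ (cycle-degree≥2 C j) deg
  ... | no x∉C = forest (record { k = k ; c = c ; inj = inj ; step = step ; close = close
                                ; inW = λ j → x∈p∧x≢y⇒x∈p-y (inW j) (λ e → x∉C (j , e)) })
    where open CycleIn C

  sparse-colour : ∀ {t} x U (f : Fin n → Fin t) (B : Subset t) → ∣ nbhd G x ∩ U ∣ < 2 * ∣ B ∣ →
                  ∃[ c ] c ∈ B × ∣ nbhd G x ∩ colourClass G U f c ∣ ≤ 1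
  sparse-colour x U f B few with any? (λ c → c ∈? B ×-dec ∣ nbhd G x ∩ colourClass G U f c ∣ ≤? 1)
  ... | yes found = found
  ... | no none = contradiction (disjoint-pigeonhole colourClass-disjoint 2 (nbhd G x ∩ U) B crowded) (<⇒≱ few)
    where
    crowded : ∀ {c} → c ∈ B → 2 ≤ ∣ (nbhd G x ∩ U) ∩ colourClass G U f c ∣
    crowded {c} c∈B = ≤-trans (≰⇒> (λ ≤1 → none (c , c∈B , ≤1))) (p⊆q⇒∣p∣≤∣q∣ restrict)
      where
      restrict : nbhd G x ∩ colourClass G U f c ⊆ (nbhd G x ∩ U) ∩ colourClass G U f c
      restrict v∈ with x∈p∩q⁻ (nbhd G x) _ v∈
      ... | v∈N , v∈c = x∈p∩q⁺ (x∈p∩q⁺ (v∈N , proj₁ (∈-colourClass⁻ v∈c)) , v∈c)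

  module _ {m t} (vs : Fin m → Fin n) (σ : Fin m → Fin t) (f : Fin n → Fin t) where

    extend : Fin n → Fin t
    extend v with any? (λ i → vs i ≟ v)
    ... | yes (i , _) = σ i
    ... | no _        = f v

    extend-vs : Injective _≡_ _≡_ vs → ∀ i → extend (vs i) ≡ σ i
    extend-vs vs-injective i with any? (λ j → vs j ≟ vs i)
    ... | yes (j , vsj≡vsi) = cong σ (vs-injective vsj≡vsi)
    ... | no none           = contradiction (i , refl) none

    extend-∉ : ∀ {v} → v ∉ setOf G vs → extend v ≡ f v
    extend-∉ {v} v∉S with any? (λ i → vs i ≟ v)
    ... | yes (i , refl) = contradiction (∈-setOf⁺ i) v∉S
    ... | no _           = refl

    module _ (vs-injective : Injective _≡_ _≡_ vs) (σ-injective : Injective _≡_ _≡_ σ) (i : Fin m) where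

      extend-colourClass : colourClass G (allV G) extend (σ i) - vs i ≡ colourClass G (∁ (setOf G vs)) f (σ i)
      extend-colourClass = ⊆-antisym new⊆old old⊆new
        where
        new⊆old : colourClass G (allV G) extend (σ i) - vs i ⊆ colourClass G (∁ (setOf G vs)) f (σ i)
        new⊆old {v} v∈ with ∈-colourClass⁻ (p─q⊆p _ ⁅ vs i ⁆ v∈) | v ∈? setOf G vs
        ... | _ , gv≡σi | no v∉S = ∈-colourClass⁺ (x∉p⇒x∈∁p v∉S) (trans (sym (extend-∉ v∉S)) gv≡σi)
        ... | _ , gv≡σi | yes v∈S with ∈-setOf⁻ v∈S
        ...   | j , refl = contradiction (cong vs (σ-injective (trans (sym (extend-vs vs-injective j)) gv≡σi)))
                                         (x∉⁅y⁆⇒x≢y (x∈p─q⇒x∉q v∈))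
        old⊆new : colourClass G (∁ (setOf G vs)) f (σ i) ⊆ colourClass G (allV G) extend (σ i) - vs i
        old⊆new {v} v∈ with ∈-colourClass⁻ v∈
        ... | v∈∁S , fv≡σi = x∈p∧x≢y⇒x∈p-y (∈-colourClass⁺ ∈-allV (trans (extend-∉ v∉S) fv≡σi))
                                            λ { refl → v∉S (∈-setOf⁺ i) }
          where
          v∉S : v ∉ setOf G vs
          v∉S = x∈∁p⇒x∉p v∈∁S

      extend-∣colourClass∣ : ∣ colourClass G (allV G) extend (σ i) ∣ ≡ suc ∣ colourClass G (∁ (setOf G vs)) f (σ i) ∣
      extend-∣colourClass∣ =
        trans (x∈p⇒∣p∣≡1+∣p-x∣ (∈-colourClass⁺ ∈-allV (extend-vs vs-injective i)))
              (cong (suc ∘ ∣_∣) extend-colourClass)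

lemma3p1 : (G : Graph) (t : ℕ) → 1 ≤ t
    → (vs : Fin t → Fin (Graph.n G)) → Injective _≡_ _≡_ vs
    → HasEquitableTreeColouring G t (∁ (setOf G vs))
    → (∀ (i : Fin t) → ∣ nbhd G (vs i) ∩ ∁ (setOf G vs) ∣ ≤ 2 * suc (toℕ i) ∸ 1)
    → HasEquitableTreeColouring G t (allV G)
lemma3p1 G t _ vs vs-injective (f , equitable , forest) deg = g , equitable′ , forest′
  where
  S : Subset (Graph.n G)
  S = setOf G vs

  -- 2 * suc (toℕ i) reduces to a suc, so 2 * suc (toℕ i) ∸ 1 < 2 * suc (toℕ i) is s≤s of ≤-refl.
  few : ∀ i (B : Subset t) → toℕ i < ∣ B ∣ → ∣ nbhd G (vs i) ∩ ∁ S ∣ < 2 * ∣ B ∣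
  few i B i<∣B∣ = ≤-trans (s≤s (deg i)) (*-monoʳ-≤ 2 i<∣B∣)

  open GoodBijection (greedy-goodBijection ⊤ (∣⊤∣≡n t) _ λ i B → sparse-colour G (vs i) (∁ S) f B ∘ few i B)

  g : Fin (Graph.n G) → Fin t
  g = extend G vs σ f

  equitable′ : ∀ c d → ∣ colourClass G (allV G) g c ∣ ≤ ∣ colourClass G (allV G) g d ∣ + 1
  equitable′ c d with σ-onto (∈⊤ {x = c}) | σ-onto (∈⊤ {x = d})
  ... | i , refl | j , refl
    rewrite extend-∣colourClass∣ G vs σ f vs-injective σ-injective i
          | extend-∣colourClass∣ G vs σ f vs-injective σ-injective j = s≤s (equitable (σ i) (σ j))

  forest′ : ∀ c → InducesForest G (colourClass G (allV G) g c)
  forest′ c with σ-onto (∈⊤ {x = c})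
  ... | i , refl = forest-extend G
    (subst (InducesForest G) (sym new-vsi≡old) (forest (σ i)))
    (subst (λ W → ∣ nbhd G (vs i) ∩ W ∣ ≤ 1) (sym new-vsi≡old) (σ-good i))
    where
    new-vsi≡old : colourClass G (allV G) g (σ i) - vs i ≡ colourClass G (∁ S) f (σ i)
    new-vsi≡old = extend-colourClass G vs σ f vs-injective σ-injective i
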